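{- Let $G$ be a connected graph and let $v,v'$ be two vertices of $G$ having equal $m$-boundary for some positive integer $m$. Then for every vertex $w\in V(G)\setminus\big(N(v,m)\cup N(v',m)\big)$, $d(v,w)=d(v',w)$.
   Context: Graphs are simple and connected; $d$ is the shortest-path distance. For a vertex $v$ and positive integer $m$: $N(v,m)=\{w: d(v,w)\le m\}$, $S(v,m)=\{w: d(v,w)=m\}$, $\partial N(v,m)=\{w\in S(v,m): d(w,V(G)\setminus N(v,m))=1\}$. Two distinct vertices $v,v'$ have equal $m$-boundary if $\partial N(v,m)=\partial N(v',m)\neq\emptyset$. -}

module Defs where

open import Data.Nat using (ℕ; zero; suc; _≤_; _<_)
open import Data.Fin using (Fin)
open import Data.Product using (Σ; ∃; _×_; _,_)
open import Data.Empty using (⊥)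
open import Relation.Nullary using (¬_)
open import Relation.Binary.PropositionalEquality using (_≡_)
open import Function.Bundles using (_⇔_)

record Graph : Set₁ where
  field
    n      : ℕ
    Adj    : Fin n → Fin n → Set
    sym    : ∀ {u w} → Adj u w → Adj w u
    irrefl : ∀ {u} → ¬ Adj u u

module _ (G : Graph) where
  open Graph G

  V : Set
  V = Fin n

  data Walk : V → V → ℕ → Set where
    nil  : ∀ {u} → Walk u u 0
    cons : ∀ {u w x k} → Adj u w → Walk w x k → Walk u x (suc k)

  Connected : Set
  Connected = ∀ u w → ∃ λ k → Walk u w k

  Dist : V → V → ℕ → Set
  Dist u w k = Walk u w k × (∀ j → Walk u w j → k ≤ j)

  InBall : V → ℕ → V → Set
  InBall v m w = ∃ λ k → Dist v w k × k ≤ m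

  InSphere : V → ℕ → V → Set
  InSphere v m w = Dist v w m

  InBoundary : V → ℕ → V → Set
  InBoundary v m w = InSphere v m w × (∃ λ u → ¬ InBall v m u × Dist w u 1)

  EqualBoundary : ℕ → V → V → Set
  EqualBoundary m v v' =
    ¬ (v ≡ v') × (∀ w → InBoundary v m w ⇔ InBoundary v' m w)
      × (∃ λ w → InBoundary v m w)

-- Take a shortest walk from v to a vertex w outside N(v,m). Its vertex x at
-- distance m from v is followed by a vertex at distance m + 1, so x lies on
-- ∂N(v,m) = ∂N(v',m), hence d(v',x) = m and d(v',w) ≤ m + d(x,w) = d(v,w).
-- Exchanging v and v' gives equality.
module Submission where

open import Defs
open import Data.Nat using (ℕ; zero; suc; _+_; _≤_; _<_; _≤?_)
open import Data.Nat.Properties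
  using (+-suc; n<1+n; +-comm; +-cancelˡ-≤; +-cancelʳ-≤; ≤-antisym; ≰⇒>; <⇒≱; m≤n⇒∃[o]m+o≡n)
open import Data.Product using (∃; _×_; _,_; proj₁)
open import Relation.Binary.PropositionalEquality using (_≡_; refl; subst)
open import Relation.Nullary using (¬_; yes; no; contradiction)
open import Function.Bundles using (Equivalence)

module _ (G : Graph) where

  _++ʷ_ : ∀ {u x w a b} → Walk G u x a → Walk G x w b → Walk G u w (a + b)
  nil      ++ʷ q = q
  cons e p ++ʷ q = cons e (p ++ʷ q)

  splitAt : ∀ {u w} a b → Walk G u w (a + b) → ∃ λ x → Walk G u x a × Walk G x w b
  splitAt zero    b p          = _ , nil , p
  splitAt (suc a) b (cons e p) with splitAt a b p
  ... | x , p₁ , p₂ = x , cons e p₁ , p₂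

  Dist-unique : ∀ {u w j k} → Dist G u w j → Dist G u w k → j ≡ k
  Dist-unique (p , minimal) (q , minimal′) = ≤-antisym (minimal _ q) (minimal′ _ p)

  Dist-split : ∀ {u x w} a b → Dist G u w (a + b) →
               Walk G u x a → Walk G x w b → Dist G u x a × Dist G x w b
  Dist-split a b (_ , minimal) p q =
      (p , λ j p′ → +-cancelʳ-≤ b a j (minimal _ (p′ ++ʷ q)))
    , (q , λ j q′ → +-cancelˡ-≤ a b j (minimal _ (p ++ʷ q′)))

  ¬InBall⇒< : ∀ {u w m k} → ¬ InBall G u m w → Dist G u w k → m < k
  ¬InBall⇒< {m = m} {k} w∉N d with k ≤? m
  ... | yes k≤m = contradiction (k , d , k≤m) w∉N
  ... | no  k≰m = ≰⇒> k≰m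

  <⇒¬InBall : ∀ {u w m k} → m < k → Dist G u w k → ¬ InBall G u m w
  <⇒¬InBall m<k d (j , d′ , j≤m) rewrite Dist-unique d d′ = <⇒≱ m<k j≤m

  Dist-last-step : ∀ {v y} m → Dist G v y (suc m) →
                   ∃ λ x → Dist G v x m × Dist G x y 1
  Dist-last-step m d with subst (Dist G _ _) (+-comm 1 m) d
  ... | d′ with splitAt m 1 (proj₁ d′)
  ... | x , p , e = x , Dist-split m 1 d′ p e

  boundary-on-geodesic : ∀ {v w} m r → Dist G v w (suc m + r) →
                         ∃ λ x → InBoundary G v m x × Walk G x w (suc r)
  boundary-on-geodesic m r d with splitAt (suc m) r (proj₁ d)
  ... | y , p , q with Dist-split (suc m) r d p q
  ... | v↝y , _ with Dist-last-step m v↝y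
  ... | x , v↝x , x↝y =
    x , (v↝x , y , <⇒¬InBall (n<1+n m) v↝y , x↝y) , proj₁ x↝y ++ʷ q

  Dist-≤-outside-ball : ∀ {v v′ w m k k′} →
    (∀ x → InBoundary G v m x → InBoundary G v′ m x) → ¬ InBall G v m w →
    Dist G v w k → Dist G v′ w k′ → k′ ≤ k
  Dist-≤-outside-ball {m = m} {k′ = k′} ∂v⊆∂v′ w∉N d (_ , minimal′)
    with m≤n⇒∃[o]m+o≡n (¬InBall⇒< w∉N d)
  ... | r , refl with boundary-on-geodesic m r d
  ... | x , x∈∂v , x↝w =
    subst (k′ ≤_) (+-suc m r) (minimal′ _ (proj₁ (proj₁ (∂v⊆∂v′ x x∈∂v)) ++ʷ x↝w))

lemma2p5 : (G : Graph) → Connected G → (m : ℕ) → 1 ≤ m → (v v' : V G) →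
    EqualBoundary G m v v' →
    (w : V G) → ¬ InBall G v m w → ¬ InBall G v' m w →
    (k k' : ℕ) → Dist G v w k → Dist G v' w k' → k ≡ k'
lemma2p5 G _ m _ v v' (_ , ∂v⇔∂v′ , _) w w∉N w∉N′ k k' d d′ =
  ≤-antisym (Dist-≤-outside-ball G (λ x → Equivalence.from (∂v⇔∂v′ x)) w∉N′ d′ d)
            (Dist-≤-outside-ball G (λ x → Equivalence.to (∂v⇔∂v′ x)) w∉N d d′)
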